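{- For any positive integer $N$, as $n\to\infty$, \begin{equation*} \mathrm{spt}(n, N) = \frac{n^N}{(N!)^2} + O(n^{N-1}). \end{equation*}
   Context: $\mathrm{spt}(n,N)$ is the total number of occurrences of the smallest part, summed over all partitions of $n$ whose largest part is $\leq N$. -}

module Defs where

open import Data.Nat using (ℕ; zero; suc; _+_; _*_; _∸_; _≤_; _⊓_; _≟_; _≤?_)
open import Data.List using (List; []; _∷_; _++_; map; concatMap; replicate; upTo; filter; length; foldr)
open import Data.Nat.ListAction using (sum)
open import Data.Nat using (NonZero; _!; _^_)
open import Data.Integer using (+_)
open import Data.Rational using (ℚ; _/_)
open import Data.Nat.Properties using (m*n≢0; _!≢0)

-- Partitions of n all of whose parts are ≤ m, each listed as a
-- non-increasing list of positive parts.
partitionsBounded : ℕ → ℕ → List (List ℕ)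
partitionsBounded zero    zero    = [] ∷ []
partitionsBounded (suc _) zero    = []
partitionsBounded n       (suc m) =
  concatMap
    (λ j → map (replicate j (suc m) ++_) (partitionsBounded (n ∸ j * suc m) m))
    (filter (λ j → j * suc m ≤? n) (upTo (suc n)))

-- Number of occurrences of the smallest part of a partition
-- (0 for the empty partition, which has no parts).
smallestPartCount : List ℕ → ℕ
smallestPartCount []       = 0
smallestPartCount (x ∷ xs) =
  length (filter (λ y → y ≟ foldr _⊓_ x xs) (x ∷ xs))

spt : ℕ → ℕ → ℕ
spt n N = sum (map smallestPartCount (partitionsBounded n N))

factSq≢0 : (N : ℕ) → NonZero (N ! * N !)
factSq≢0 N = m*n≢0 (N !) (N !) {{N !≢0}} {{N !≢0}}

mainTerm : ℕ → ℕ → ℚ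
mainTerm n N = _/_ (+ (n ^ N)) (N ! * N !) {{factSq≢0 N}}

module Submission where

open import Defs

-- We prove  (N!)² spt(n, N) = n^N + O(n^(N−1))  over ℕ and divide by (N!)².
--
-- Sorting the partitions of n with parts ≤ m + 1 by the multiplicity j of the part m + 1
-- gives the recurrence
--     spt(n, m+1) = Σ_{j(m+1) ≤ n} ( spt(n − j(m+1), m) + j · [n = j(m+1)] ),
-- the second term counting the partitions made of copies of m + 1 only.  By induction on t,
-- (t+1)!² spt(n, t+1) lies within C_t (n+1)^t of n^(t+1) for all n: for t = 0 one has
-- spt(n, 1) = n; in the step to P = t + 2 the hypothesis turns the recurrence into the power
-- sum Σ_j (n − jP)^(t+1), which P² times is n^P up to P² n^(t+1) by telescoping the binomial
-- estimates  b^(K+1) + Q(K+1) b^K ≤ (b+Q)^(K+1) ≤ b^(K+1) + Q(K+1) (b+Q)^K,  while the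
-- boundary terms j · [n = jP] add at most n.  For n ≥ 1, (n+1)^t ≤ 2^t n^t.

module NaturalEstimates where

  open import Data.Nat.Base
  open import Data.Nat.Properties
  open import Data.Nat.ListAction using (sum)
  open import Data.Nat.ListAction.Properties using (sum-++)
  open import Data.Nat.Solver using (module +-*-Solver)
  open import Data.List.Base
    using (List; []; _∷_; _++_; map; concatMap; replicate; upTo; applyUpTo; filter; length; foldr)
  open import Data.List.Properties
    using (filter-accept; filter-all; filter-none; filter-++; length-++; length-replicate;
           map-++; map-∘; map-cong; map-cong-local; foldr-fusion)
  open import Data.List.Relation.Unary.All as All using (All; []; _∷_)
  open import Data.List.Relation.Unary.All.Properties
    using (++⁺; replicate⁺; map⁺; concat⁺; applyUpTo⁺₂)
  open import Data.Product using (_×_; _,_; proj₁; proj₂; ∃-syntax)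
  open import Function using (_∘_)
  open import Relation.Binary.PropositionalEquality
  open import Relation.Nullary using (yes; no; ¬_)
  open import Algebra.Properties.CommutativeSemigroup ⊓-commutativeSemigroup using (x∙yz≈y∙xz)
  open import Algebra.Properties.CommutativeSemigroup +-commutativeSemigroup
    using () renaming (interchange to +-interchange)
  open +-*-Solver

  δ₀ : ℕ → ℕ
  δ₀ zero    = 1
  δ₀ (suc _) = 0

  -- stridedSum Q g b r = Σ_{k < b, kQ ≤ r} g k (r ∸ kQ): the k-th summand sees the number
  -- k of blocks of size Q removed from r and the remainder.  The fuel b bounds k; it is
  -- irrelevant as soon as b > r and Q ≥ 1.
  stridedSum : ℕ → (ℕ → ℕ → ℕ) → ℕ → ℕ → ℕ
  stridedSum Q g zero    r = 0
  stridedSum Q g (suc b) r with Q ≤? r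
  ... | yes _ = g 0 r + stridedSum Q (g ∘ suc) b (r ∸ Q)
  ... | no  _ = g 0 r

  stridedSum-cong : ∀ Q {g h} → (∀ k r → g k r ≡ h k r) →
    ∀ b r → stridedSum Q g b r ≡ stridedSum Q h b r
  stridedSum-cong Q g≗h zero    r = refl
  stridedSum-cong Q g≗h (suc b) r with Q ≤? r
  ... | yes _ = cong₂ _+_ (g≗h 0 r) (stridedSum-cong Q (g≗h ∘ suc) b (r ∸ Q))
  ... | no  _ = g≗h 0 r

  stridedSum-mono : ∀ Q {g h} → (∀ k r → g k r ≤ h k r) →
    ∀ b r → stridedSum Q g b r ≤ stridedSum Q h b r
  stridedSum-mono Q g≤h zero    r = z≤n
  stridedSum-mono Q g≤h (suc b) r with Q ≤? r
  ... | yes _ = +-mono-≤ (g≤h 0 r) (stridedSum-mono Q (g≤h ∘ suc) b (r ∸ Q))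
  ... | no  _ = g≤h 0 r

  stridedSum-+ : ∀ Q g h b r →
    stridedSum Q (λ k s → g k s + h k s) b r ≡ stridedSum Q g b r + stridedSum Q h b r
  stridedSum-+ Q g h zero    r = refl
  stridedSum-+ Q g h (suc b) r with Q ≤? r
  ... | yes _ = begin
    (g 0 r + h 0 r) + stridedSum Q (λ k s → g (suc k) s + h (suc k) s) b (r ∸ Q)
      ≡⟨ cong ((g 0 r + h 0 r) +_) (stridedSum-+ Q (g ∘ suc) (h ∘ suc) b (r ∸ Q)) ⟩
    (g 0 r + h 0 r) + (G + H)
      ≡⟨ +-interchange (g 0 r) (h 0 r) G H ⟩
    (g 0 r + G) + (h 0 r + H) ∎
    where
    open ≡-Reasoning
    G = stridedSum Q (g ∘ suc) b (r ∸ Q)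
    H = stridedSum Q (h ∘ suc) b (r ∸ Q)
  ... | no  _ = refl

  stridedSum-* : ∀ Q c g b r → stridedSum Q (λ k s → c * g k s) b r ≡ c * stridedSum Q g b r
  stridedSum-* Q c g zero    r = sym (*-zeroʳ c)
  stridedSum-* Q c g (suc b) r with Q ≤? r
  ... | yes _ = trans (cong (c * g 0 r +_) (stridedSum-* Q c (g ∘ suc) b (r ∸ Q)))
                      (sym (*-distribˡ-+ c (g 0 r) _))
  ... | no  _ = refl

  stridedSum-vanish : ∀ Q {g} → (∀ k r → g k r ≡ 0) → ∀ b r → stridedSum Q g b r ≡ 0
  stridedSum-vanish Q g≡0 b r = trans (stridedSum-cong Q g≡0 b r) (stridedSum-* Q 0 (λ _ _ → 0) b r)

  stridedSum-head : ∀ Q {g} → (∀ k r → g (suc k) r ≡ 0) → ∀ b r → stridedSum Q g (suc b) r ≡ g 0 r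
  stridedSum-head Q tail≡0 b r with Q ≤? r
  ... | yes _ = trans (cong (_ +_) (stridedSum-vanish Q tail≡0 b (r ∸ Q))) (+-identityʳ _)
  ... | no  _ = refl

  -- The form in which partitionsBounded enumerates multiplicities: the sum of h j (n ∸ jQ)
  -- over those j in the list js with jQ ≤ n.
  listedSum : ℕ → (ℕ → ℕ → ℕ) → List ℕ → ℕ → ℕ
  listedSum Q h js n = sum (map (λ j → h j (n ∸ j * Q)) (filter (λ j → j * Q ≤? n) js))

  listedSum-accept : ∀ Q h j js n → j * Q ≤ n →
    listedSum Q h (j ∷ js) n ≡ h j (n ∸ j * Q) + listedSum Q h js n
  listedSum-accept Q h j js n jQ≤n =
    cong (sum ∘ map (λ j → h j (n ∸ j * Q))) (filter-accept (λ j → j * Q ≤? n) jQ≤n)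

  listedSum-vanish : ∀ Q h f s b n → (∀ k → f k ≡ s + k) → n < s * Q →
    listedSum Q h (applyUpTo f b) n ≡ 0
  listedSum-vanish Q h f s b n f≡s+ n<sQ =
    cong (sum ∘ map (λ j → h j (n ∸ j * Q)))
         (filter-none (λ j → j * Q ≤? n) (applyUpTo⁺₂ f b rejected))
    where
    rejected : ∀ k → ¬ (f k * Q ≤ n)
    rejected k fkQ≤n = <⇒≱ n<sQ (≤-trans (*-monoˡ-≤ Q s≤fk) fkQ≤n)
      where
      s≤fk : s ≤ f k
      s≤fk = subst (s ≤_) (sym (f≡s+ k)) (m≤m+n s k)

  listedSum-stridedSum : ∀ Q h f s b n → (∀ k → f k ≡ s + k) → s * Q ≤ n →
    listedSum Q h (applyUpTo f b) n ≡ stridedSum Q (h ∘ f) b (n ∸ s * Q)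
  listedSum-stridedSum Q h f s zero    n f≡s+ sQ≤n = refl
  listedSum-stridedSum Q h f s (suc b) n f≡s+ sQ≤n = begin
    listedSum Q h (f 0 ∷ applyUpTo (f ∘ suc) b) n
      ≡⟨ listedSum-accept Q h (f 0) _ n (subst (λ j → j * Q ≤ n) (sym f0≡s) sQ≤n) ⟩
    h (f 0) (n ∸ f 0 * Q) + listedSum Q h (applyUpTo (f ∘ suc) b) n
      ≡⟨ cong (λ j → h (f 0) (n ∸ j * Q) + listedSum Q h (applyUpTo (f ∘ suc) b) n) f0≡s ⟩
    h (f 0) (n ∸ s * Q) + listedSum Q h (applyUpTo (f ∘ suc) b) n
      ≡⟨ peel ⟩
    stridedSum Q (h ∘ f) (suc b) (n ∸ s * Q) ∎
    where
    open ≡-Reasoning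
    f0≡s : f 0 ≡ s
    f0≡s = trans (f≡s+ 0) (+-identityʳ s)
    f∘suc≡s+ : ∀ k → f (suc k) ≡ suc s + k
    f∘suc≡s+ k = trans (f≡s+ (suc k)) (+-suc s k)
    peel : h (f 0) (n ∸ s * Q) + listedSum Q h (applyUpTo (f ∘ suc) b) n
           ≡ stridedSum Q (h ∘ f) (suc b) (n ∸ s * Q)
    peel with Q ≤? n ∸ s * Q
    ... | yes Q≤rest = cong (h (f 0) (n ∸ s * Q) +_) (begin
      listedSum Q h (applyUpTo (f ∘ suc) b) n
        ≡⟨ listedSum-stridedSum Q h (f ∘ suc) (suc s) b n f∘suc≡s+ (m≤o∸n⇒m+n≤o Q sQ≤n Q≤rest) ⟩
      stridedSum Q (h ∘ f ∘ suc) b (n ∸ (Q + s * Q))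
        ≡⟨ cong (stridedSum Q (h ∘ f ∘ suc) b) remainder ⟩
      stridedSum Q (h ∘ f ∘ suc) b (n ∸ s * Q ∸ Q) ∎)
      where
      remainder : n ∸ (Q + s * Q) ≡ n ∸ s * Q ∸ Q
      remainder = trans (cong (n ∸_) (+-comm Q (s * Q))) (sym (∸-+-assoc n (s * Q) Q))
    ... | no Q≰rest =
      trans (cong (h (f 0) (n ∸ s * Q) +_) (listedSum-vanish Q h (f ∘ suc) (suc s) b n f∘suc≡s+ n<[1+s]Q))
            (+-identityʳ _)
      where
      n<[1+s]Q : n < Q + s * Q
      n<[1+s]Q = ≰⇒> (λ [1+s]Q≤n → Q≰rest (m+n≤o⇒m≤o∸n Q [1+s]Q≤n))

  binomial-lower : ∀ K b Q → b ^ suc K + Q * suc K * b ^ K ≤ (b + Q) ^ suc K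
  binomial-lower zero b Q =
    ≤-reflexive (solve 2 (λ b Q → b :* con 1 :+ Q :* con 1 :* con 1 := (b :+ Q) :* con 1) refl b Q)
  binomial-lower (suc K) b Q = begin
    b * (b * x) + Q * suc (suc K) * (b * x)
      ≤⟨ m≤m+n _ (Q * Q * suc K * x) ⟩
    b * (b * x) + Q * suc (suc K) * (b * x) + Q * Q * suc K * x
      ≡⟨ solve 4 (λ b Q K x → b :* (b :* x) :+ Q :* (con 2 :+ K) :* (b :* x) :+ Q :* Q :* (con 1 :+ K) :* x
                  := (b :+ Q) :* (b :* x :+ Q :* (con 1 :+ K) :* x)) refl b Q K x ⟩
    (b + Q) * (b ^ suc K + Q * suc K * b ^ K)
      ≤⟨ *-monoʳ-≤ (b + Q) (binomial-lower K b Q) ⟩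
    (b + Q) * (b + Q) ^ suc K ∎
    where
    open ≤-Reasoning
    x = b ^ K

  binomial-upper : ∀ K b Q → (b + Q) ^ suc K ≤ b ^ suc K + Q * suc K * (b + Q) ^ K
  binomial-upper zero b Q =
    ≤-reflexive (solve 2 (λ b Q → (b :+ Q) :* con 1 := b :* con 1 :+ Q :* con 1 :* con 1) refl b Q)
  binomial-upper (suc K) b Q = begin
    (b + Q) * (b + Q) ^ suc K
      ≡⟨ *-distribʳ-+ ((b + Q) ^ suc K) b Q ⟩
    b * (b + Q) ^ suc K + Q * ((b + Q) * y)
      ≤⟨ +-monoˡ-≤ _ (*-monoʳ-≤ b (binomial-upper K b Q)) ⟩
    b * (b * x + Q * suc K * y) + Q * ((b + Q) * y)
      ≡⟨ cong (_+ Q * ((b + Q) * y))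
           (solve 5 (λ b Q K y x → b :* (b :* x :+ Q :* (con 1 :+ K) :* y)
                                  := b :* (b :* x) :+ Q :* (con 1 :+ K) :* (b :* y)) refl b Q K y x) ⟩
    b * (b * x) + Q * suc K * (b * y) + Q * ((b + Q) * y)
      ≤⟨ +-monoˡ-≤ _ (+-monoʳ-≤ (b * (b * x)) (*-monoʳ-≤ (Q * suc K) (*-monoˡ-≤ y (m≤m+n b Q)))) ⟩
    b * (b * x) + Q * suc K * ((b + Q) * y) + Q * ((b + Q) * y)
      ≡⟨ solve 5 (λ b Q K y bbx → bbx :+ Q :* (con 1 :+ K) :* ((b :+ Q) :* y) :+ Q :* ((b :+ Q) :* y)
                   := bbx :+ Q :* (con 2 :+ K) :* ((b :+ Q) :* y)) refl b Q K y (b * (b * x)) ⟩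
    b * (b * x) + Q * suc (suc K) * ((b + Q) * y) ∎
    where
    open ≤-Reasoning
    x = b ^ K
    y = (b + Q) ^ K

  -- Upper bound for the power sum Σ_j (n − jQ)^K by telescoping binomial-lower.
  powerSum-upper : ∀ Q K b n →
    Q * suc K * stridedSum Q (λ _ r → r ^ K) b n ≤ n ^ suc K + Q * suc K * n ^ K
  powerSum-upper Q K zero    n = ≤-trans (≤-reflexive (*-zeroʳ (Q * suc K))) z≤n
  powerSum-upper Q K (suc b) n with Q ≤? n
  ... | yes Q≤n = begin
    Q * suc K * (n ^ K + W)
      ≡⟨ *-distribˡ-+ (Q * suc K) (n ^ K) W ⟩
    Q * suc K * n ^ K + Q * suc K * W
      ≤⟨ +-monoʳ-≤ (Q * suc K * n ^ K) (powerSum-upper Q K b a) ⟩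
    Q * suc K * n ^ K + (a ^ suc K + Q * suc K * a ^ K)
      ≤⟨ +-monoʳ-≤ (Q * suc K * n ^ K) (binomial-lower K a Q) ⟩
    Q * suc K * n ^ K + (a + Q) ^ suc K
      ≡⟨ cong (λ m → Q * suc K * n ^ K + m ^ suc K) (m∸n+n≡m Q≤n) ⟩
    Q * suc K * n ^ K + n ^ suc K
      ≡⟨ +-comm (Q * suc K * n ^ K) _ ⟩
    n ^ suc K + Q * suc K * n ^ K ∎
    where
    open ≤-Reasoning
    a = n ∸ Q
    W = stridedSum Q (λ _ r → r ^ K) b a
  ... | no _ = m≤n+m (Q * suc K * n ^ K) (n ^ suc K)

  -- Lower bound for the same power sum by telescoping binomial-upper; here the fuel must
  -- exceed n so that all terms are present.
  powerSum-lower : ∀ q K b n → n < b →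
    n ^ suc K ≤ suc q * suc K * stridedSum (suc q) (λ _ r → r ^ K) b n
  powerSum-lower q K (suc b) n (s≤s n≤b) with suc q ≤? n
  ... | yes Q≤n = begin
    n ^ suc K
      ≡⟨ cong (_^ suc K) (sym (m∸n+n≡m Q≤n)) ⟩
    (a + Q) ^ suc K
      ≤⟨ binomial-upper K a Q ⟩
    a ^ suc K + Q * suc K * (a + Q) ^ K
      ≡⟨ cong (λ m → a ^ suc K + Q * suc K * m ^ K) (m∸n+n≡m Q≤n) ⟩
    a ^ suc K + Q * suc K * n ^ K
      ≤⟨ +-monoˡ-≤ _ (powerSum-lower q K b a a<b) ⟩
    Q * suc K * W + Q * suc K * n ^ K
      ≡⟨ +-comm (Q * suc K * W) _ ⟩
    Q * suc K * n ^ K + Q * suc K * W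
      ≡⟨ *-distribˡ-+ (Q * suc K) (n ^ K) W ⟨
    Q * suc K * (n ^ K + W) ∎
    where
    open ≤-Reasoning
    Q = suc q
    a = n ∸ Q
    W = stridedSum Q (λ _ r → r ^ K) b a
    a<b : a < b
    a<b = <-≤-trans (∸-monoʳ-< {n} {Q} {0} z<s Q≤n) n≤b
  ... | no Q≰n = *-monoˡ-≤ (n ^ K) (≤-trans (<⇒≤ (≰⇒> Q≰n)) (m≤m*n (suc q) (suc K)))

  -- Σ_j (n − jQ + 1)^K ≤ (n+1)^(K+1) for Q ≥ 1: at most n + 1 terms, each ≤ (n+1)^K.
  shiftedPowerSum-upper : ∀ q K b n → stridedSum (suc q) (λ _ r → suc r ^ K) b n ≤ suc n ^ suc K
  shiftedPowerSum-upper q K zero    n = z≤n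
  shiftedPowerSum-upper q K (suc b) n with suc q ≤? n
  ... | yes Q≤n = begin
    suc n ^ K + stridedSum (suc q) (λ _ r → suc r ^ K) b a
      ≤⟨ +-monoʳ-≤ (suc n ^ K) (shiftedPowerSum-upper q K b a) ⟩
    suc n ^ K + suc a ^ suc K
      ≤⟨ +-monoʳ-≤ (suc n ^ K) (^-monoˡ-≤ (suc K) (∸-monoʳ-< {n} {suc q} {0} z<s Q≤n)) ⟩
    suc n ^ K + n * n ^ K
      ≤⟨ +-monoʳ-≤ (suc n ^ K) (*-monoʳ-≤ n (^-monoˡ-≤ K (n≤1+n n))) ⟩
    suc n ^ K + n * suc n ^ K ∎
    where
    open ≤-Reasoning
    a = n ∸ suc q
  ... | no _ = m≤m+n (suc n ^ K) (n * suc n ^ K)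

  -- A strided sum whose k-th summand is at most (c + k)·[remainder = 0] has only one
  -- possibly nonzero term, of index k ≤ n, so it is at most c + n.
  boundarySum-upper : ∀ q c b n {g} → (∀ k r → g k r ≤ (c + k) * δ₀ r) →
    stridedSum (suc q) g b n ≤ c + n
  boundarySum-upper q c zero n g≤ = z≤n
  boundarySum-upper q c (suc b) n {g} g≤ with suc q ≤? n
  boundarySum-upper q c (suc b) (suc n) {g} g≤ | yes Q≤n = begin
    g 0 (suc n) + stridedSum (suc q) (g ∘ suc) b (n ∸ q)
      ≤⟨ +-monoˡ-≤ _ (≤-trans (g≤ 0 (suc n)) (≤-reflexive (*-zeroʳ (c + 0)))) ⟩
    stridedSum (suc q) (g ∘ suc) b (n ∸ q)
      ≤⟨ boundarySum-upper q (suc c) b (n ∸ q)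
           (λ k r → subst (λ i → g (suc k) r ≤ i * δ₀ r) (+-suc c k) (g≤ (suc k) r)) ⟩
    suc c + (n ∸ q)
      ≤⟨ s≤s (+-monoʳ-≤ c (m∸n≤m n q)) ⟩
    suc (c + n)
      ≡⟨ +-suc c n ⟨
    c + suc n ∎
    where open ≤-Reasoning
  boundarySum-upper q c (suc b) n {g} g≤ | no _ = begin
    g 0 n            ≤⟨ g≤ 0 n ⟩
    (c + 0) * δ₀ n   ≤⟨ *-monoʳ-≤ (c + 0) (δ₀≤1 n) ⟩
    (c + 0) * 1      ≡⟨ trans (*-identityʳ _) (+-identityʳ c) ⟩
    c                ≤⟨ m≤m+n c n ⟩
    c + n            ∎
    where
    open ≤-Reasoning
    δ₀≤1 : ∀ n → δ₀ n ≤ 1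
    δ₀≤1 zero    = ≤-refl
    δ₀≤1 (suc n) = z≤n

  -- For stride 1 and enough fuel the unique nonzero term has index exactly n.
  boundarySum-unitStride : ∀ c b n {g} → (∀ k r → g k r ≡ (c + k) * δ₀ r) → n < b →
    stridedSum 1 g b n ≡ c + n
  boundarySum-unitStride c (suc b) zero    g≡ _ = trans (g≡ 0 0) (*-identityʳ (c + 0))
  boundarySum-unitStride c (suc b) (suc n) {g} g≡ (s≤s n<b) = begin
    g 0 (suc n) + stridedSum 1 (g ∘ suc) b n
      ≡⟨ cong₂ _+_ (trans (g≡ 0 (suc n)) (*-zeroʳ (c + 0)))
                   (boundarySum-unitStride (suc c) b n
                      (λ k r → trans (g≡ (suc k) r) (cong (_* δ₀ r) (+-suc c k))) n<b) ⟩
    suc c + n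
      ≡⟨ +-suc c n ⟨
    c + suc n ∎
    where open ≡-Reasoning

  isNil : List ℕ → ℕ
  isNil []      = 1
  isNil (_ ∷ _) = 0

  ⊓-foldr : ∀ a b zs → a ⊓ foldr _⊓_ b zs ≡ foldr _⊓_ (a ⊓ b) zs
  ⊓-foldr a b = foldr-fusion (a ⊓_) b (λ x y → x∙yz≈y∙xz a x y)

  foldr-⊓-≤-seed : ∀ s zs → foldr _⊓_ s zs ≤ s
  foldr-⊓-≤-seed s []       = ≤-refl
  foldr-⊓-≤-seed s (z ∷ zs) = ≤-trans (m⊓n≤n z _) (foldr-⊓-≤-seed s zs)

  foldr-⊓-replicate : ∀ j a → foldr _⊓_ a (replicate j a ++ []) ≡ a
  foldr-⊓-replicate zero    a = refl
  foldr-⊓-replicate (suc j) a = trans (cong (a ⊓_) (foldr-⊓-replicate j a)) (⊓-idem a)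

  foldr-⊓-prepend : ∀ j a y ys → foldr _⊓_ y ys ≤ a →
    foldr _⊓_ a (replicate j a ++ y ∷ ys) ≡ foldr _⊓_ y ys
  foldr-⊓-prepend zero a y ys v≤a = begin
    y ⊓ foldr _⊓_ a ys   ≡⟨ ⊓-foldr y a ys ⟩
    foldr _⊓_ (y ⊓ a) ys ≡⟨ cong (λ s → foldr _⊓_ s ys) (⊓-comm y a) ⟩
    foldr _⊓_ (a ⊓ y) ys ≡⟨ ⊓-foldr a y ys ⟨
    a ⊓ foldr _⊓_ y ys   ≡⟨ m≥n⇒m⊓n≡n v≤a ⟩
    foldr _⊓_ y ys       ∎
    where open ≡-Reasoning
  foldr-⊓-prepend (suc j) a y ys v≤a =
    trans (cong (a ⊓_) (foldr-⊓-prepend j a y ys v≤a)) (m≥n⇒m⊓n≡n v≤a)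

  count : ℕ → List ℕ → ℕ
  count v xs = length (filter (_≟ v) xs)

  count-++ : ∀ v xs ys → count v (xs ++ ys) ≡ count v xs + count v ys
  count-++ v xs ys = trans (cong length (filter-++ (_≟ v) xs ys)) (length-++ (filter (_≟ v) xs))

  count-replicate-≡ : ∀ j a → count a (replicate j a) ≡ j
  count-replicate-≡ j a = trans (cong length (filter-all (_≟ a) (replicate⁺ j refl))) (length-replicate j)

  count-replicate-≢ : ∀ j {a v} → a ≢ v → count v (replicate j a) ≡ 0
  count-replicate-≢ j a≢v = cong length (filter-none (_≟ _) (replicate⁺ j a≢v))

  -- Adding j parts equal to m + 1 to a partition with parts ≤ m keeps its smallest part and
  -- its count, unless the partition is empty, when the j new parts are the smallest ones.
  smallestPartCount-prepend : ∀ m j μ → All (_≤ m) μ →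
    smallestPartCount (replicate j (suc m) ++ μ) ≡ smallestPartCount μ + j * isNil μ
  smallestPartCount-prepend m zero    []       _ = refl
  smallestPartCount-prepend m zero    (y ∷ ys) _ = sym (+-identityʳ _)
  smallestPartCount-prepend m (suc j) []       _ = begin
    count (foldr _⊓_ (suc m) (replicate j (suc m) ++ [])) (replicate (suc j) (suc m) ++ [])
      ≡⟨ cong (λ v → count v (replicate (suc j) (suc m) ++ [])) (foldr-⊓-replicate j (suc m)) ⟩
    count (suc m) (replicate (suc j) (suc m) ++ [])
      ≡⟨ count-++ (suc m) (replicate (suc j) (suc m)) [] ⟩
    count (suc m) (replicate (suc j) (suc m)) + 0
      ≡⟨ cong (_+ 0) (count-replicate-≡ (suc j) (suc m)) ⟩
    suc j + 0
      ≡⟨ +-identityʳ (suc j) ⟩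
    suc j
      ≡⟨ *-identityʳ (suc j) ⟨
    suc j * 1 ∎
    where open ≡-Reasoning
  smallestPartCount-prepend m (suc j) (y ∷ ys) (y≤m ∷ _) = begin
    count (foldr _⊓_ (suc m) (replicate j (suc m) ++ y ∷ ys)) (replicate (suc j) (suc m) ++ y ∷ ys)
      ≡⟨ cong (λ w → count w (replicate (suc j) (suc m) ++ y ∷ ys))
              (foldr-⊓-prepend j (suc m) y ys (m≤n⇒m≤1+n v≤m)) ⟩
    count v (replicate (suc j) (suc m) ++ y ∷ ys)
      ≡⟨ count-++ v (replicate (suc j) (suc m)) (y ∷ ys) ⟩
    count v (replicate (suc j) (suc m)) + count v (y ∷ ys)
      ≡⟨ cong (_+ count v (y ∷ ys)) (count-replicate-≢ (suc j) 1+m≢v) ⟩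
    count v (y ∷ ys)
      ≡⟨ +-identityʳ _ ⟨
    count v (y ∷ ys) + 0
      ≡⟨ cong (count v (y ∷ ys) +_) (*-zeroʳ (suc j)) ⟨
    count v (y ∷ ys) + suc j * 0 ∎
    where
    open ≡-Reasoning
    v = foldr _⊓_ y ys
    v≤m : v ≤ m
    v≤m = ≤-trans (foldr-⊓-≤-seed y ys) y≤m
    1+m≢v : suc m ≢ v
    1+m≢v 1+m≡v = 1+n≰n (subst (_≤ m) (sym 1+m≡v) v≤m)

  withCopies : ℕ → ℕ → ℕ → List (List ℕ)
  withCopies n m j = map (replicate j (suc m) ++_) (partitionsBounded (n ∸ j * suc m) m)

  partitionsBounded-suc : ∀ n m →
    partitionsBounded n (suc m)
    ≡ concatMap (withCopies n m) (filter (λ j → j * suc m ≤? n) (upTo (suc n)))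
  partitionsBounded-suc zero    m = refl
  partitionsBounded-suc (suc n) m = refl

  partitionsBounded-parts≤ : ∀ m n → All (All (_≤ m)) (partitionsBounded n m)
  partitionsBounded-parts≤ zero    zero    = [] ∷ []
  partitionsBounded-parts≤ zero    (suc n) = []
  partitionsBounded-parts≤ (suc m) n =
    subst (All (All (_≤ suc m))) (sym (partitionsBounded-suc n m))
          (concat⁺ (map⁺ (All.universal withCopies-parts≤ (filter (λ j → j * suc m ≤? n) (upTo (suc n))))))
    where
    withCopies-parts≤ : ∀ j → All (All (_≤ suc m)) (withCopies n m j)
    withCopies-parts≤ j = map⁺ (All.map (λ ν≤m → ++⁺ (replicate⁺ j ≤-refl) (All.map m≤n⇒m≤1+n ν≤m))
                                        (partitionsBounded-parts≤ m (n ∸ j * suc m)))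

  sum-map-concatMap : ∀ {A B : Set} (g : B → ℕ) (F : A → List B) xs →
    sum (map g (concatMap F xs)) ≡ sum (map (λ x → sum (map g (F x))) xs)
  sum-map-concatMap g F []       = refl
  sum-map-concatMap g F (x ∷ xs) = begin
    sum (map g (F x ++ concatMap F xs))
      ≡⟨ cong sum (map-++ g (F x) _) ⟩
    sum (map g (F x) ++ map g (concatMap F xs))
      ≡⟨ sum-++ (map g (F x)) _ ⟩
    sum (map g (F x)) + sum (map g (concatMap F xs))
      ≡⟨ cong (sum (map g (F x)) +_) (sum-map-concatMap g F xs) ⟩
    sum (map g (F x)) + sum (map (λ x → sum (map g (F x))) xs) ∎
    where open ≡-Reasoning

  sum-map-linear : ∀ {A : Set} (f h : A → ℕ) c xs →
    sum (map (λ x → f x + c * h x) xs) ≡ sum (map f xs) + c * sum (map h xs)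
  sum-map-linear f h c []       = sym (*-zeroʳ c)
  sum-map-linear f h c (x ∷ xs) rewrite sum-map-linear f h c xs =
    solve 5 (λ a b c d e → (a :+ e :* b) :+ (c :+ e :* d) := (a :+ c) :+ e :* (b :+ d))
      refl (f x) (h x) (sum (map f xs)) (sum (map h xs)) c

  sum-map-zero : ∀ {A : Set} (xs : List A) → sum (map (λ _ → 0) xs) ≡ 0
  sum-map-zero []       = refl
  sum-map-zero (_ ∷ xs) = sum-map-zero xs

  sum-partitionsBounded-suc : ∀ (g : List ℕ → ℕ) n m →
    sum (map g (partitionsBounded n (suc m)))
    ≡ stridedSum (suc m) (λ j r → sum (map (g ∘ (replicate j (suc m) ++_)) (partitionsBounded r m))) (suc n) n
  sum-partitionsBounded-suc g n m = begin
    sum (map g (partitionsBounded n (suc m)))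
      ≡⟨ cong (sum ∘ map g) (partitionsBounded-suc n m) ⟩
    sum (map g (concatMap (withCopies n m) js))
      ≡⟨ sum-map-concatMap g (withCopies n m) js ⟩
    sum (map (λ j → sum (map g (withCopies n m j))) js)
      ≡⟨ cong sum (map-cong (λ j → cong sum (sym (map-∘ (partitionsBounded (n ∸ j * suc m) m)))) js) ⟩
    listedSum (suc m) h (upTo (suc n)) n
      ≡⟨ listedSum-stridedSum (suc m) h (λ k → k) 0 (suc n) n (λ _ → refl) z≤n ⟩
    stridedSum (suc m) h (suc n) n ∎
    where
    open ≡-Reasoning
    js = filter (λ j → j * suc m ≤? n) (upTo (suc n))
    h = λ j r → sum (map (g ∘ (replicate j (suc m) ++_)) (partitionsBounded r m))

  emptyCount : ∀ m n → sum (map isNil (partitionsBounded n m)) ≡ δ₀ n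
  emptyCount zero    zero    = refl
  emptyCount zero    (suc n) = refl
  emptyCount (suc m) n = begin
    sum (map isNil (partitionsBounded n (suc m)))
      ≡⟨ sum-partitionsBounded-suc isNil n m ⟩
    stridedSum (suc m) (λ j r → sum (map (isNil ∘ (replicate j (suc m) ++_)) (partitionsBounded r m))) (suc n) n
      ≡⟨ stridedSum-head (suc m) (λ _ r → sum-map-zero (partitionsBounded r m)) n n ⟩
    sum (map isNil (partitionsBounded n m))
      ≡⟨ emptyCount m n ⟩
    δ₀ n ∎
    where open ≡-Reasoning

  spt-recurrence : ∀ n m → spt n (suc m) ≡ stridedSum (suc m) (λ j r → spt r m + j * δ₀ r) (suc n) n
  spt-recurrence n m =
    trans (sum-partitionsBounded-suc smallestPartCount n m) (stridedSum-cong (suc m) summand (suc n) n)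
    where
    summand : ∀ j r → sum (map (smallestPartCount ∘ (replicate j (suc m) ++_)) (partitionsBounded r m))
                      ≡ spt r m + j * δ₀ r
    summand j r = begin
      sum (map (smallestPartCount ∘ (replicate j (suc m) ++_)) (partitionsBounded r m))
        ≡⟨ cong sum (map-cong-local (All.map (λ {ν} → smallestPartCount-prepend m j ν)
                                              (partitionsBounded-parts≤ m r))) ⟩
      sum (map (λ ν → smallestPartCount ν + j * isNil ν) (partitionsBounded r m))
        ≡⟨ sum-map-linear smallestPartCount isNil j (partitionsBounded r m) ⟩
      spt r m + j * sum (map isNil (partitionsBounded r m))
        ≡⟨ cong (λ e → spt r m + j * e) (emptyCount m r) ⟩
      spt r m + j * δ₀ r ∎
      where open ≡-Reasoning

  -- The base case N = 1: the only partition of n into parts ≤ 1 has n smallest parts.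
  spt-one : ∀ n → spt n 1 ≡ n
  spt-one n = trans (spt-recurrence n 0) (boundarySum-unitStride 0 (suc n) n summand ≤-refl)
    where
    spt-zero : ∀ r → spt r 0 ≡ 0
    spt-zero zero    = refl
    spt-zero (suc r) = refl
    summand : ∀ k r → spt r 0 + k * δ₀ r ≡ k * δ₀ r
    summand k r = cong (_+ k * δ₀ r) (spt-zero r)

  Within : ℕ → ℕ → ℕ → Set
  Within e x y = x ≤ y + e × y ≤ x + e

  ≡⇒Within : ∀ e {x y} → x ≡ y → Within e x y
  ≡⇒Within e {x} refl = m≤m+n x e , m≤m+n x e

  Within-weaken : ∀ {e e′ x y} → e ≤ e′ → Within e x y → Within e′ x y
  Within-weaken {x = x} {y} e≤e′ (x≤ , y≤) =
    ≤-trans x≤ (+-monoʳ-≤ y e≤e′) , ≤-trans y≤ (+-monoʳ-≤ x e≤e′)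

  Within-trans : ∀ {e e′ x y z} → Within e x y → Within e′ y z → Within (e + e′) x z
  Within-trans {e} {e′} {x} {y} {z} (x≤ , y≤) (y≤′ , z≤) =
    subst (λ d → x ≤ z + d) (+-comm e′ e) (chain {c = z} {d′ = e′} x≤ y≤′) ,
    chain {c = x} {d′ = e} z≤ y≤
    where
    chain : ∀ {a b c d d′} → a ≤ b + d → b ≤ c + d′ → a ≤ c + (d′ + d)
    chain {a} {b} {c} {d} {d′} a≤ b≤ = begin
      a            ≤⟨ a≤ ⟩
      b + d        ≤⟨ +-monoˡ-≤ d b≤ ⟩
      c + d′ + d   ≡⟨ +-assoc c d′ d ⟩
      c + (d′ + d) ∎
      where open ≤-Reasoning

  Within-scale : ∀ c {e x y} → Within e x y → Within (c * e) (c * x) (c * y)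
  Within-scale c {e} {x} {y} (x≤ , y≤) =
    ≤-trans (*-monoʳ-≤ c x≤) (≤-reflexive (*-distribˡ-+ c y e)) ,
    ≤-trans (*-monoʳ-≤ c y≤) (≤-reflexive (*-distribˡ-+ c x e))

  Within-+ : ∀ {d e e′ x y} → d ≤ e′ → Within e x y → Within (e + e′) (x + d) y
  Within-+ {d} {e} {e′} {x} {y} d≤e′ (x≤ , y≤) =
    ≤-trans (+-mono-≤ x≤ d≤e′) (≤-reflexive (+-assoc y e e′)) ,
    ≤-trans y≤ (+-mono-≤ (m≤m+n x d) (m≤m+n e e′))

  Within-stridedSum : ∀ Q {e f g} → (∀ k r → Within (e k r) (f k r) (g k r)) →
    ∀ b r → Within (stridedSum Q e b r) (stridedSum Q f b r) (stridedSum Q g b r)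
  Within-stridedSum Q {e} {f} {g} close b r =
    bound (λ k r → proj₁ (close k r)) , bound (λ k r → proj₂ (close k r))
    where
    bound : ∀ {u v} → (∀ k r → u k r ≤ v k r + e k r) →
            stridedSum Q u b r ≤ stridedSum Q v b r + stridedSum Q e b r
    bound {u} {v} u≤ = ≤-trans (stridedSum-mono Q u≤ b r) (≤-reflexive (stridedSum-+ Q v e b r))

  powerSum-Within : ∀ q K n →
    Within (suc q * suc K * n ^ K) (suc q * suc K * stridedSum (suc q) (λ _ r → r ^ K) (suc n) n) (n ^ suc K)
  powerSum-Within q K n =
    powerSum-upper (suc q) K (suc n) n , ≤-trans (powerSum-lower q K (suc n) n ≤-refl) (m≤m+n _ _)

  sqFactorial : ℕ → ℕ
  sqFactorial N = N ! * N !

  SptEstimate : ℕ → ℕ → Set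
  SptEstimate t C = ∀ n → Within (C * suc n ^ t) (sqFactorial (suc t) * spt n (suc t)) (n ^ suc t)

  -- The inductive step from N = t + 1 to P = t + 2.  Writing the recurrence as a strided sum
  -- WS of spt( · , t+1) plus boundary terms WE, the hypothesis makes D·WS close to the power
  -- sum Wp (D = (t+1)!²), P² Wp is close to n^P, and WE ≤ n.
  spt-step : ∀ t C → SptEstimate t C →
    SptEstimate (suc t) (suc (suc t) * suc (suc t) * (C + 1 + sqFactorial (suc t)))
  spt-step t C estimate n =
    subst (λ x → Within (P * P * (C + 1 + D) * X) x (n ^ P)) (sym expand) (Within-weaken errorBound combined)
    where
    P = suc (suc t)
    D = sqFactorial (suc t)
    X = suc n ^ suc t
    WS = stridedSum P (λ _ r → spt r (suc t)) (suc n) n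
    WE = stridedSum P (λ k r → k * δ₀ r) (suc n) n
    Wp = stridedSum P (λ _ r → r ^ suc t) (suc n) n
    Wc = stridedSum P (λ _ r → suc r ^ t) (suc n) n

    expand : sqFactorial P * spt n P ≡ P * P * (D * WS) + P * P * D * WE
    expand = begin
      sqFactorial P * spt n P
        ≡⟨ cong (sqFactorial P *_) (trans (spt-recurrence n (suc t)) (stridedSum-+ P _ _ (suc n) n)) ⟩
      (P * F) * (P * F) * (WS + WE)
        ≡⟨ solve 4 (λ P F WS WE → (P :* F) :* (P :* F) :* (WS :+ WE)
                                := P :* P :* (F :* F :* WS) :+ P :* P :* (F :* F) :* WE) refl P F WS WE ⟩
      P * P * (D * WS) + P * P * D * WE ∎
      where
      open ≡-Reasoning
      F = suc t !

    summed : Within (C * Wc) (D * WS) Wp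
    summed = subst₂ (λ e x → Within e x Wp) (stridedSum-* P C _ (suc n) n) (stridedSum-* P D _ (suc n) n)
                    (Within-stridedSum P {λ _ r → C * suc r ^ t} (λ _ r → estimate r) (suc n) n)

    combined : Within (P * P * (C * Wc) + P * P * n ^ suc t + P * P * D * n)
                      (P * P * (D * WS) + P * P * D * WE) (n ^ P)
    combined = Within-+ (*-monoʳ-≤ (P * P * D) (boundarySum-upper (suc t) 0 (suc n) n (λ _ _ → ≤-refl)))
                        (Within-trans (Within-scale (P * P) summed) (powerSum-Within (suc t) (suc t) n))

    errorBound : P * P * (C * Wc) + P * P * n ^ suc t + P * P * D * n ≤ P * P * (C + 1 + D) * X
    errorBound = begin
      P * P * (C * Wc) + P * P * n ^ suc t + P * P * D * n
        ≤⟨ +-mono-≤ (+-mono-≤ (*-monoʳ-≤ (P * P) (*-monoʳ-≤ C (shiftedPowerSum-upper (suc t) t (suc n) n)))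
                              (*-monoʳ-≤ (P * P) (^-monoˡ-≤ (suc t) (n≤1+n n))))
                    (*-monoʳ-≤ (P * P * D) n≤X) ⟩
      P * P * (C * X) + P * P * X + P * P * D * X
        ≡⟨ solve 4 (λ PP C D X → PP :* (C :* X) :+ PP :* X :+ PP :* D :* X := PP :* (C :+ con 1 :+ D) :* X)
                   refl (P * P) C D X ⟩
      P * P * (C + 1 + D) * X ∎
      where
      open ≤-Reasoning
      n≤X : n ≤ X
      n≤X = ≤-trans (n≤1+n n)
              (≤-trans (≤-reflexive (sym (^-identityʳ (suc n)))) (^-monoʳ-≤ (suc n) {1} {suc t} (s≤s z≤n)))

  sptEstimate : ∀ t → ∃[ C ] SptEstimate t C
  sptEstimate zero    =
    0 , λ n → ≡⇒Within 0 (trans (*-identityˡ (spt n 1)) (trans (spt-one n) (sym (^-identityʳ n))))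
  sptEstimate (suc t) with sptEstimate t
  ... | C , estimate = suc (suc t) * suc (suc t) * (C + 1 + sqFactorial (suc t)) , spt-step t C estimate

  suc^≤2^*^ : ∀ t n → 1 ≤ n → suc n ^ t ≤ 2 ^ t * n ^ t
  suc^≤2^*^ zero    n 1≤n = ≤-refl
  suc^≤2^*^ (suc t) n 1≤n = begin
    suc n * suc n ^ t            ≤⟨ *-mono-≤ (+-monoˡ-≤ n 1≤n) (suc^≤2^*^ t n 1≤n) ⟩
    (n + n) * (2 ^ t * n ^ t)
      ≡⟨ solve 3 (λ n a b → (n :+ n) :* (a :* b) := con 2 :* a :* (n :* b)) refl n (2 ^ t) (n ^ t) ⟩
    2 * 2 ^ t * (n * n ^ t)      ∎
    where open ≤-Reasoning

  spt-asymptotic : ∀ t → ∃[ C ] (∀ n → 1 ≤ n →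
    Within (C * n ^ t) (spt n (suc t) * sqFactorial (suc t)) (n ^ suc t))
  spt-asymptotic t with sptEstimate t
  ... | C , estimate = C * 2 ^ t , λ n 1≤n →
    subst (λ x → Within (C * 2 ^ t * n ^ t) x (n ^ suc t)) (*-comm (sqFactorial (suc t)) (spt n (suc t)))
      (Within-weaken (≤-trans (*-monoʳ-≤ C (suc^≤2^*^ t n 1≤n)) (≤-reflexive (sym (*-assoc C (2 ^ t) (n ^ t)))))
                     (estimate n))

-- Transport of a natural-number estimate  |a·d − e| ≤ M·x  to the rational inequality
-- |a − e/d| ≤ M·x, through unnormalised rationals.
module RationalTransfer where

  open import Data.Nat.Base as ℕ using (ℕ; suc; NonZero)
  import Data.Nat.Properties as ℕₚ
  open import Data.Integer.Base as ℤ using (+_; _⊖_)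
  import Data.Integer.Properties as ℤₚ
  open import Data.Rational.Unnormalised.Base as ℚᵘ using (mkℚᵘ; *≤*)
  import Data.Rational.Unnormalised.Properties as ℚᵘₚ
  open import Data.Rational.Base as ℚ using (_/_; toℚᵘ)
  import Data.Rational.Properties as ℚₚ
  open import Data.Product using (_,_)
  open import Data.Sum using (inj₁; inj₂)
  open import Relation.Binary.PropositionalEquality
  open NaturalEstimates using (Within)

  Within⇒∣⊖∣≤ : ∀ {k u e} → Within k u e → ℤ.∣ u ⊖ e ∣ ℕ.≤ k
  Within⇒∣⊖∣≤ {k} {u} {e} (u≤ , e≤) with ℕₚ.≤-total u e
  ... | inj₁ u≤e = subst (ℕ._≤ k) (sym (ℤₚ.∣⊖∣-≤ u≤e)) (ℕₚ.m≤n+o⇒m∸n≤o e u e≤)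
  ... | inj₂ e≤u =
    subst (ℕ._≤ k) (sym (trans (ℤₚ.∣m⊖n∣≡∣n⊖m∣ u e) (ℤₚ.∣⊖∣-≤ e≤u))) (ℕₚ.m≤n+o⇒m∸n≤o u e u≤)

  -- The statement for unnormalised rationals, where a/1 − e/d has numerator a·d − e.
  Within⇒∣-∣≤ᵘ : ∀ a e d′ M x → Within (M ℕ.* x) (a ℕ.* suc d′) e →
    ℚᵘ.∣ mkℚᵘ (+ a) 0 ℚᵘ.- mkℚᵘ (+ e) d′ ∣ ℚᵘ.≤ mkℚᵘ (+ M) 0 ℚᵘ.* mkℚᵘ (+ x) 0
  Within⇒∣-∣≤ᵘ a e d′ M x close = *≤* (subst₂ ℤ._≤_ (sym lhs) (sym rhs) (ℤ.+≤+ bound))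
    where
    u = a ℕ.* suc d′
    k = ℤ.∣ u ⊖ e ∣
    numerator : + a ℤ.* + suc d′ ℤ.+ ℤ.- (+ e) ℤ.* + 1 ≡ u ⊖ e
    numerator = trans (cong₂ ℤ._+_ (sym (ℤₚ.pos-* a (suc d′))) (ℤₚ.*-identityʳ (ℤ.- (+ e))))
                      (ℤₚ.m-n≡m⊖n u e)
    lhs : + ℤ.∣ + a ℤ.* + suc d′ ℤ.+ ℤ.- (+ e) ℤ.* + 1 ∣ ℤ.* + 1 ≡ + (k ℕ.* 1)
    lhs = trans (cong (λ i → + ℤ.∣ i ∣ ℤ.* + 1) numerator) (sym (ℤₚ.pos-* k 1))
    rhs : (+ M ℤ.* + x) ℤ.* + (1 ℕ.* suc d′) ≡ + ((M ℕ.* x) ℕ.* (1 ℕ.* suc d′))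
    rhs = trans (cong (ℤ._* + (1 ℕ.* suc d′)) (sym (ℤₚ.pos-* M x)))
                (sym (ℤₚ.pos-* (M ℕ.* x) (1 ℕ.* suc d′)))
    bound : k ℕ.* 1 ℕ.≤ (M ℕ.* x) ℕ.* (1 ℕ.* suc d′)
    bound = ℕₚ.≤-trans (ℕₚ.≤-reflexive (ℕₚ.*-identityʳ k))
              (ℕₚ.≤-trans (Within⇒∣⊖∣≤ close) (ℕₚ.m≤m*n (M ℕ.* x) (1 ℕ.* suc d′)))

  Within⇒∣-∣≤ : ∀ a e d .{{_ : NonZero d}} M x → Within (M ℕ.* x) (a ℕ.* d) e →
    ℚ.∣ (+ a / 1) ℚ.- (+ e / d) ∣ ℚ.≤ (+ M / 1) ℚ.* (+ x / 1)
  Within⇒∣-∣≤ a e (suc d′) M x close =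
    ℚₚ.toℚᵘ-cancel-≤ (ℚᵘₚ.≤-respʳ-≃ (ℚᵘₚ.≃-sym rhs)
                       (ℚᵘₚ.≤-respˡ-≃ (ℚᵘₚ.≃-sym lhs) (Within⇒∣-∣≤ᵘ a e d′ M x close)))
    where
    A = + a / 1
    B = + e / suc d′
    lhs : toℚᵘ (ℚ.∣ A ℚ.- B ∣) ℚᵘ.≃ ℚᵘ.∣ mkℚᵘ (+ a) 0 ℚᵘ.- mkℚᵘ (+ e) d′ ∣
    lhs = ℚᵘₚ.≃-trans (ℚₚ.toℚᵘ-homo-∣-∣ (A ℚ.- B)) (ℚᵘₚ.∣-∣-cong
            (ℚᵘₚ.≃-trans (ℚₚ.toℚᵘ-homo-+ A (ℚ.- B))
              (ℚᵘₚ.+-cong (ℚₚ.toℚᵘ-fromℚᵘ (mkℚᵘ (+ a) 0))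
                (ℚᵘₚ.≃-trans (ℚₚ.toℚᵘ-homo‿- B) (ℚᵘₚ.-‿cong (ℚₚ.toℚᵘ-fromℚᵘ (mkℚᵘ (+ e) d′)))))))
    rhs : toℚᵘ ((+ M / 1) ℚ.* (+ x / 1)) ℚᵘ.≃ mkℚᵘ (+ M) 0 ℚᵘ.* mkℚᵘ (+ x) 0
    rhs = ℚᵘₚ.≃-trans (ℚₚ.toℚᵘ-homo-* (+ M / 1) (+ x / 1))
            (ℚᵘₚ.*-cong (ℚₚ.toℚᵘ-fromℚᵘ (mkℚᵘ (+ M) 0)) (ℚₚ.toℚᵘ-fromℚᵘ (mkℚᵘ (+ x) 0)))

open NaturalEstimates using (sqFactorial; spt-asymptotic)
open RationalTransfer using (Within⇒∣-∣≤)
open import Data.Nat using (ℕ; _≤_; _∸_; _^_; suc)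
open import Data.Product using (∃-syntax; _,_)
open import Data.Integer using (+_)
open import Data.Rational using (_/_; _-_; ∣_∣; _*_) renaming (_≤_ to _≤ℚ_)

theorem2p6 : (N : ℕ) → 1 ≤ N →
    ∃[ C ] ∃[ n₀ ] ((n : ℕ) → n₀ ≤ n →
      ∣ (+ spt n N / 1) - mainTerm n N ∣ ≤ℚ (+ C / 1) * (+ (n ^ (N ∸ 1)) / 1))
theorem2p6 (suc t) _ with spt-asymptotic t
... | C , estimate = C , 1 , λ n 1≤n →
  Within⇒∣-∣≤ (spt n (suc t)) (n ^ suc t) (sqFactorial (suc t)) {{factSq≢0 (suc t)}} C (n ^ t) (estimate n 1≤n)
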